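{- Let $f\colon\{0,\dots,n\}\to\mathbb{Z}$ be $\Delta_f$-near concave and $g\colon\{0,\dots,m\}\to\mathbb{Z}$ be $\Delta_g$-near concave, where $\Delta_f,\Delta_g\ge0$. Then the max-plus convolution $h$ of $f$ and $g$ is $\Delta_h$-near concave for some $\Delta_h\le\max\{\Delta_f,\Delta_g\}$.
   Context: For $\Delta\ge0$, $f\colon\{0,\dots,n\}\to\mathbb{Z}$ is $\Delta$-near convex if there is a convex $\breve f\colon\{0,\dots,n\}\to\mathbb{Q}$ (i.e. $\breve f(i)-\breve f(i-1)\le\breve f(i+1)-\breve f(i)$ for $1\le i\le n-1$) with $\breve f(i)\le f(i)\le\breve f(i)+\Delta$ for all $i$; $f$ is $\Delta$-near concave if $-f$ is $\Delta$-near convex. The max-plus convolution is $h\colon\{0,\dots,n+m\}\to\mathbb{Z}$, $h(k)=\max\{f(i)+g(j): i+j=k,\ 0\le i\le n,\ 0\le j\le m\}$. -}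

module Defs where

open import Data.Nat using (ℕ; suc)
open import Data.Fin using (Fin; toℕ)
import Data.Integer as ℤ
open ℤ using (ℤ)
open import Data.Rational using (ℚ; _≤_; _+_; _-_)
open import Data.Product using (Σ; _×_)
open import Relation.Binary.PropositionalEquality using (_≡_)

toℚ : ℤ → ℚ
toℚ z = Data.Rational._/_ z 1

Convex : (n : ℕ) → (Fin (suc n) → ℚ) → Set
Convex n b = ∀ (i j k : Fin (suc n)) →
  suc (toℕ i) ≡ toℕ j → suc (toℕ j) ≡ toℕ k →
  b j - b i ≤ b k - b j

NearConvex : (n : ℕ) → ℚ → (Fin (suc n) → ℤ) → Set
NearConvex n Δ f = Σ (Fin (suc n) → ℚ) λ b →
  Convex n b × (∀ i → b i ≤ toℚ (f i)) × (∀ i → toℚ (f i) ≤ b i + Δ)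

NearConcave : (n : ℕ) → ℚ → (Fin (suc n) → ℤ) → Set
NearConcave n Δ f = NearConvex n Δ (λ i → ℤ.- f i)

IsMaxPlusConv : (n m : ℕ) → (Fin (suc n) → ℤ) → (Fin (suc m) → ℤ) →
  (Fin (suc (n Data.Nat.+ m)) → ℤ) → Set
IsMaxPlusConv n m f g h = ∀ (k : Fin (suc (n Data.Nat.+ m))) →
  (Σ (Fin (suc n)) λ i → Σ (Fin (suc m)) λ j →
     (toℕ i Data.Nat.+ toℕ j ≡ toℕ k) × (h k ≡ f i ℤ.+ g j))
  × (∀ (i : Fin (suc n)) (j : Fin (suc m)) →
     toℕ i Data.Nat.+ toℕ j ≡ toℕ k → f i ℤ.+ g j ℤ.≤ h k)

{-# OPTIONS --safe #-}
module Submission where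

-- Pass to u = -f, v = -g, W = -h: W is the min-plus convolution of the Δf- and Δg-near convex u and v.
-- For a slope s, let [a, b] and [c, d] be ranges of minimisers of u i - s i and v j - s j. The line of
-- slope s through the minimal value of the tilted sum lies below W. At k = a + j with c ≤ j ≤ d, the
-- convex envelope of v lies below the chord of its tilt between c and d, so W k exceeds the line by at
-- most Δg; symmetrically for k = i + d with a ≤ i ≤ b. Walking k from 0 to n + m while merging the
-- edges of the lower hulls of u and v by slope produces such a line for every k, and the maximum of
-- all these lines is a convex function within max Δf Δg below W.

open import Defs

module NearConvexMinPlus where
  open import Data.Nat.Base as ℕ using (ℕ; zero; suc; _∸_; z≤n; s≤s)
  import Data.Nat.Properties as ℕ
  import Data.Nat.Coprimality as Coprime
  open import Data.Integer.Base as ℤ using (ℤ; +_; -[1+_])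
  import Data.Integer.Properties as ℤ
  open import Data.Rational.Base
  open import Data.Rational.Properties
  import Data.Rational.Unnormalised.Base as ℚᵘ
  import Data.Rational.Unnormalised.Properties as ℚᵘ
  open import Data.Rational.Solver using (module +-*-Solver)
  open +-*-Solver
  open import Data.Fin.Base using (Fin; toℕ; fromℕ<; fromℕ)
  import Data.Fin.Properties as Fin
  open import Data.Product.Base using (∃; ∃₂; _×_; _,_; proj₁; proj₂)
  open import Data.Sum.Base using (inj₁; inj₂)
  open import Data.Empty using (⊥-elim)
  open import Function.Base using (_∘_)
  open import Relation.Nullary using (yes; no; ¬_)
  open import Relation.Binary.PropositionalEquality

  toℚ≡mkℚ : ∀ z → toℚ z ≡ mkℚ z 0 (Coprime.sym (Coprime.1-coprimeTo _))
  toℚ≡mkℚ (+ n)    = normalize-coprime (Coprime.sym (Coprime.1-coprimeTo n))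
  toℚ≡mkℚ -[1+ n ] = cong -_ (normalize-coprime (Coprime.sym (Coprime.1-coprimeTo (suc n))))

  toℚᵘ∘toℚ : ∀ z → toℚᵘ (toℚ z) ≡ ℚᵘ.mkℚᵘ z 0
  toℚᵘ∘toℚ z rewrite toℚ≡mkℚ z = refl

  toℚ-+ : ∀ a b → toℚ (a ℤ.+ b) ≡ toℚ a + toℚ b
  toℚ-+ a b = toℚᵘ-injective (begin
      toℚᵘ (toℚ (a ℤ.+ b))            ≡⟨ toℚᵘ∘toℚ (a ℤ.+ b) ⟩
      ℚᵘ.mkℚᵘ (a ℤ.+ b) 0             ≈⟨ ℚᵘ.*≡* (cong (ℤ._* + 1) (cong₂ ℤ._+_ (ℤ.*-identityʳ a) (ℤ.*-identityʳ b))) ⟨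
      ℚᵘ.mkℚᵘ a 0 ℚᵘ.+ ℚᵘ.mkℚᵘ b 0    ≡⟨ cong₂ ℚᵘ._+_ (toℚᵘ∘toℚ a) (toℚᵘ∘toℚ b) ⟨
      toℚᵘ (toℚ a) ℚᵘ.+ toℚᵘ (toℚ b)  ≈⟨ toℚᵘ-homo-+ (toℚ a) (toℚ b) ⟨
      toℚᵘ (toℚ a + toℚ b)            ∎)
    where open ℚᵘ.≃-Reasoning

  toℚ-mono-≤ : ∀ {a b} → a ℤ.≤ b → toℚ a ≤ toℚ b
  toℚ-mono-≤ {a} {b} a≤b rewrite toℚ≡mkℚ a | toℚ≡mkℚ b = *≤* (ℤ.*-monoʳ-≤-nonNeg (+ 1) a≤b)

  recip : ℕ → ℚ
  recip r = + 1 / suc r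

  -- Opaque so that ι x stays atomic: unfolding toℚ makes checking the ring-solver steps very slow.
  opaque
    ι : ℕ → ℚ
    ι x = toℚ (+ x)

    ι-+ : ∀ x y → ι (x ℕ.+ y) ≡ ι x + ι y
    ι-+ x y = toℚ-+ (+ x) (+ y)

    ι-suc : ∀ x → ι (suc x) ≡ 1ℚ + ι x
    ι-suc = ι-+ 1

    ι-nonNeg : ∀ x → 0ℚ ≤ ι x
    ι-nonNeg x = toℚ-mono-≤ {+ 0} {+ x} (ℤ.+≤+ z≤n)

    recip*ι-suc : ∀ r → recip r * ι (suc r) ≡ 1ℚ
    recip*ι-suc r = toℚᵘ-injective (begin
        toℚᵘ (recip r * ι (suc r))                 ≈⟨ toℚᵘ-homo-* (recip r) (ι (suc r)) ⟩
        toℚᵘ (recip r) ℚᵘ.* toℚᵘ (ι (suc r))       ≈⟨ ℚᵘ.*-cong (toℚᵘ-fromℚᵘ (ℚᵘ.mkℚᵘ (+ 1) r)) (ℚᵘ.≃-reflexive (toℚᵘ∘toℚ (+ suc r))) ⟩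
        ℚᵘ.mkℚᵘ (+ 1) r ℚᵘ.* ℚᵘ.mkℚᵘ (+ suc r) 0   ≈⟨ ℚᵘ.*-inverseˡ (ℚᵘ.mkℚᵘ (+ suc r) 0) ⟩
        ℚᵘ.1ℚᵘ                                      ∎)
      where open ℚᵘ.≃-Reasoning

  ι-∸ : ∀ {b i} → b ℕ.≤ i → ι i ≡ ι b + ι (i ∸ b)
  ι-∸ {b} {i} b≤i = trans (cong ι (sym (ℕ.m+[n∸m]≡n b≤i))) (ι-+ b (i ∸ b))

  recip*ι-∸ : ∀ {b i} → b ℕ.< i → recip (i ∸ suc b) * ι (i ∸ b) ≡ 1ℚ
  recip*ι-∸ {b} {i} b<i rewrite ℕ.+-∸-assoc 1 b<i = recip*ι-suc (i ∸ suc b)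

  recip-nonNeg : ∀ r → 0ℚ ≤ recip r
  recip-nonNeg r = toℚᵘ-cancel-≤ (ℚᵘ.≤-respʳ-≃ (ℚᵘ.≃-sym (toℚᵘ-fromℚᵘ (ℚᵘ.mkℚᵘ (+ 1) r))) (ℚᵘ.*≤* (ℤ.+≤+ z≤n)))

  slack⇒≤ : ∀ {p q} d → 0ℚ ≤ d → q ≡ p + d → p ≤ q
  slack⇒≤ {p} d 0≤d refl = ≤-trans (≤-reflexive (sym (+-identityʳ p))) (+-monoʳ-≤ p 0≤d)

  p≤q⇒0≤q-p : ∀ {p q} → p ≤ q → 0ℚ ≤ q - p
  p≤q⇒0≤q-p {p} p≤q = ≤-trans (≤-reflexive (sym (+-inverseʳ p))) (+-monoˡ-≤ (- p) p≤q)

  nonNeg*nonNeg : ∀ {p q} → 0ℚ ≤ p → 0ℚ ≤ q → 0ℚ ≤ p * q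
  nonNeg*nonNeg {p} 0≤p 0≤q = ≤-trans (≤-reflexive (sym (*-zeroʳ p))) (*-monoˡ-≤-nonNeg p {{nonNegative 0≤p}} 0≤q)

  ConvexOn : ℕ → (ℕ → ℚ) → Set
  ConvexOn N B = ∀ x → suc (suc x) ℕ.≤ N → B (suc x) - B x ≤ B (suc (suc x)) - B (suc x)

  tilt : ℚ → (ℕ → ℚ) → ℕ → ℚ
  tilt s u i = u i - s * ι i

  tilt-convex : ∀ {N B} s → ConvexOn N B → ConvexOn N (tilt s B)
  tilt-convex {B = B} s convex x sx≤N = begin
      tilt s B (suc x) - tilt s B x                  ≡⟨ increment x ⟩
      (B (suc x) - B x) - s                          ≤⟨ +-monoˡ-≤ (- s) (convex x sx≤N) ⟩
      (B (suc (suc x)) - B (suc x)) - s              ≡⟨ increment (suc x) ⟨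
      tilt s B (suc (suc x)) - tilt s B (suc x)      ∎
    where
    open ≤-Reasoning
    increment : ∀ y → tilt s B (suc y) - tilt s B y ≡ (B (suc y) - B y) - s
    increment y rewrite ι-suc y =
      solve 4 (λ b₁ b₀ s i → (b₁ :- s :* (con 1ℚ :+ i)) :- (b₀ :- s :* i) := (b₁ :- b₀) :- s)
        refl (B (suc y)) (B y) s (ι y)

  module _ {N : ℕ} {B : ℕ → ℚ} (convex : ConvexOn N B) where
    private
      increment-mono : ∀ l a → suc (l ℕ.+ a) ℕ.≤ N →
                       B (suc a) - B a ≤ B (suc (l ℕ.+ a)) - B (l ℕ.+ a)
      increment-mono zero    a _ = ≤-refl
      increment-mono (suc l) a p = ≤-trans (increment-mono l a (ℕ.≤-trans (ℕ.n≤1+n _) p)) (convex (l ℕ.+ a) p)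

      ≤-from-increment : ∀ x → 0ℚ ≤ B (suc x) - B x → B x ≤ B (suc x)
      ≤-from-increment x p = slack⇒≤ _ p (solve 2 (λ b₀ b₁ → b₁ := b₀ :+ (b₁ :- b₀)) refl (B x) (B (suc x)))

      bounded-on-interval : ∀ len a x α → a ℕ.≤ x → x ℕ.≤ len ℕ.+ a → len ℕ.+ a ℕ.≤ N →
                            B a ≤ α → B (len ℕ.+ a) ≤ α → B x ≤ α
      bounded-on-interval zero    a x α a≤x x≤a _ Ba≤α _ rewrite ℕ.≤-antisym x≤a a≤x = Ba≤α
      bounded-on-interval (suc l) a x α a≤x x≤e e≤N Ba≤α Be≤α with x ℕ.≟ a
      ... | yes refl = Ba≤α
      ... | no x≢a with ≤-total (B (suc a)) (B a)
      ...   | inj₁ descends = bounded-on-interval l (suc a) x α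
                (ℕ.≤∧≢⇒< a≤x (x≢a ∘ sym)) (subst (x ℕ.≤_) (sym (ℕ.+-suc l a)) x≤e)
                (subst (ℕ._≤ N) (sym (ℕ.+-suc l a)) e≤N)
                (≤-trans descends Ba≤α) (subst (λ y → B y ≤ α) (sym (ℕ.+-suc l a)) Be≤α)
      ...   | inj₂ ascends with x ℕ.≟ suc l ℕ.+ a
      ...     | yes refl = Be≤α
      -- The increments of B are nondecreasing, so once B ascends at a it ascends up to the end.
      ...     | no x≢e = bounded-on-interval l a x α a≤x (ℕ.≤-pred (ℕ.≤∧≢⇒< x≤e x≢e))
                  (ℕ.≤-trans (ℕ.n≤1+n _) e≤N) Ba≤α
                  (≤-trans (≤-from-increment (l ℕ.+ a)
                    (≤-trans (p≤q⇒0≤q-p ascends) (increment-mono l a e≤N))) Be≤α)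

    convex-≤-endpoints : ∀ {a b x α} → a ℕ.≤ x → x ℕ.≤ b → b ℕ.≤ N → B a ≤ α → B b ≤ α → B x ≤ α
    convex-≤-endpoints {a} {b} {x} {α} a≤x x≤b b≤N Ba≤α Bb≤α =
      bounded-on-interval (b ∸ a) a x α a≤x (subst (x ℕ.≤_) b≡ x≤b) (subst (ℕ._≤ N) b≡ b≤N)
        Ba≤α (subst (λ y → B y ≤ α) b≡ Bb≤α)
      where
      b≡ : b ≡ b ∸ a ℕ.+ a
      b≡ = sym (ℕ.m∸n+n≡m (ℕ.≤-trans a≤x x≤b))

  maxUpTo : (ℕ → ℚ) → ℕ → ℚ
  maxUpTo f zero    = f 0
  maxUpTo f (suc L) = maxUpTo f L ⊔ f (suc L)

  ≤-maxUpTo : ∀ f {L k} → k ℕ.≤ L → f k ≤ maxUpTo f L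
  ≤-maxUpTo f {zero}  z≤n = ≤-refl
  ≤-maxUpTo f {suc L} k≤L with ℕ.m≤n⇒m<n∨m≡n k≤L
  ... | inj₁ k<L  = ≤-trans (≤-maxUpTo f (ℕ.≤-pred k<L)) (p≤p⊔q _ _)
  ... | inj₂ refl = p≤q⊔p (maxUpTo f L) (f (suc L))

  maxUpTo-lub : ∀ f L {c} → (∀ k → k ℕ.≤ L → f k ≤ c) → maxUpTo f L ≤ c
  maxUpTo-lub f zero    bound = bound 0 z≤n
  maxUpTo-lub f (suc L) bound =
    ⊔-lub (maxUpTo-lub f L (λ k k≤L → bound k (ℕ.≤-trans k≤L (ℕ.n≤1+n L)))) (bound (suc L) ℕ.≤-refl)

  maxUpTo-attained : ∀ f L → ∃ λ k → k ℕ.≤ L × maxUpTo f L ≡ f k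
  maxUpTo-attained f zero = 0 , z≤n , refl
  maxUpTo-attained f (suc L) with ⊔-sel (maxUpTo f L) (f (suc L))
  ... | inj₂ ≡last = suc L , ℕ.≤-refl , ≡last
  ... | inj₁ ≡rest with maxUpTo-attained f L
  ...   | k , k≤L , ≡fk = k , ℕ.≤-trans k≤L (ℕ.n≤1+n L) , trans ≡rest ≡fk

  affine : ℚ → ℚ → ℕ → ℚ
  affine c σ x = c + σ * ι x

  affine-increment : ∀ c σ x → affine c σ (suc x) - affine c σ x ≡ σ
  affine-increment c σ x rewrite ι-suc x =
    solve 3 (λ c σ i → (c :+ σ :* (con 1ℚ :+ i)) :- (c :+ σ :* i) := σ) refl c σ (ι x)

  maxUpTo-affine-convex : ∀ (c σ : ℕ → ℚ) L N → ConvexOn N (λ x → maxUpTo (λ k → affine (c k) (σ k) x) L)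
  maxUpTo-affine-convex c σ L N x _ with maxUpTo-attained (λ k → affine (c k) (σ k) (suc x)) L
  ... | k , k≤L , attained = begin
      M (suc x) - M x                      ≤⟨ +-monoʳ-≤ (M (suc x)) (neg-antimono-≤ (≤-maxUpTo (λ k → affine (c k) (σ k) x) k≤L)) ⟩
      M (suc x) - ℓ x                      ≡⟨ cong (_- ℓ x) attained ⟩
      ℓ (suc x) - ℓ x                      ≡⟨ affine-increment (c k) (σ k) x ⟩
      σ k                                  ≡⟨ affine-increment (c k) (σ k) (suc x) ⟨
      ℓ (suc (suc x)) - ℓ (suc x)          ≤⟨ +-monoˡ-≤ (- ℓ (suc x)) (≤-maxUpTo (λ k → affine (c k) (σ k) (suc (suc x))) k≤L) ⟩
      M (suc (suc x)) - ℓ (suc x)          ≡⟨ cong (λ z → M (suc (suc x)) - z) attained ⟨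
      M (suc (suc x)) - M (suc x)          ∎
    where
    open ≤-Reasoning
    M : ℕ → ℚ
    M y = maxUpTo (λ k → affine (c k) (σ k) y) L
    ℓ : ℕ → ℚ
    ℓ = affine (c k) (σ k)

  argmin-range : (f : ℕ → ℚ) (lo len : ℕ) → ∃ λ j → lo ℕ.≤ j × j ℕ.≤ len ℕ.+ lo ×
                 (∀ i → lo ℕ.≤ i → i ℕ.≤ len ℕ.+ lo → f j ≤ f i)
  argmin-range f lo zero = lo , ℕ.≤-refl , ℕ.≤-refl , λ i lo≤i i≤lo → ≤-reflexive (cong f (ℕ.≤-antisym lo≤i i≤lo))
  argmin-range f lo (suc len) with argmin-range f lo len
  ... | j , lo≤j , j≤e , minimal with ≤-total (f j) (f (suc len ℕ.+ lo))
  ...   | inj₁ fj≤ = j , lo≤j , ℕ.≤-trans j≤e (ℕ.n≤1+n _) , minimal′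
    where
    minimal′ : ∀ i → lo ℕ.≤ i → i ℕ.≤ suc len ℕ.+ lo → f j ≤ f i
    minimal′ i lo≤i i≤e with ℕ.m≤n⇒m<n∨m≡n i≤e
    ... | inj₁ i<e = minimal i lo≤i (ℕ.≤-pred i<e)
    ... | inj₂ refl = fj≤
  ...   | inj₂ ≤fj = suc len ℕ.+ lo , ℕ.≤-trans (ℕ.m≤n+m lo len) (ℕ.n≤1+n _) , ℕ.≤-refl , minimal′
    where
    minimal′ : ∀ i → lo ℕ.≤ i → i ℕ.≤ suc len ℕ.+ lo → f (suc len ℕ.+ lo) ≤ f i
    minimal′ i lo≤i i≤e with ℕ.m≤n⇒m<n∨m≡n i≤e
    ... | inj₁ i<e = ≤-trans ≤fj (minimal i lo≤i (ℕ.≤-pred i<e))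
    ... | inj₂ refl = ≤-refl

  module Minimisers (N : ℕ) (u : ℕ → ℚ) where

    record Minimiser (s : ℚ) (a : ℕ) : Set where
      field
        in-range : a ℕ.≤ N
        minimal : ∀ i → i ℕ.≤ N → tilt s u a ≤ tilt s u i

    record BelowRightChords (b : ℕ) (t : ℚ) : Set where
      field
        below : ∀ i → b ℕ.< i → i ℕ.≤ N → t * ι (i ∸ b) ≤ u i - u b

    -- The chord from b to end has minimal slope among chords from b to the right,
    -- i.e. it is the edge of the lower convex hull of u leaving b.
    record HullEdge (b : ℕ) : Set where
      field
        end : ℕ
        slope : ℚ
        b<end : b ℕ.< end
        end≤N : end ℕ.≤ N
        supporting : BelowRightChords b slope
        through-end : slope * ι (end ∸ b) ≡ u end - u b

    open Minimiser
    open BelowRightChords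

    belowRightChords-mono : ∀ {b t t′} → t′ ≤ t → BelowRightChords b t → BelowRightChords b t′
    belowRightChords-mono {b} t′≤t bound .below i b<i i≤N =
      ≤-trans (*-monoʳ-≤-nonNeg (ι (i ∸ b)) {{nonNegative (ι-nonNeg (i ∸ b))}} t′≤t) (below bound i b<i i≤N)

    belowRightChords-beyond : ∀ {b t} → ¬ b ℕ.< N → BelowRightChords b t
    belowRightChords-beyond b≮N .below i b<i i≤N = ⊥-elim (b≮N (ℕ.<-≤-trans b<i i≤N))

    minimiser-below-chords : ∀ {s b} → Minimiser s b → ∀ i → b ℕ.≤ i → i ℕ.≤ N → s * ι (i ∸ b) ≤ u i - u b
    minimiser-below-chords {s} {b} b-min i b≤i i≤N = slack⇒≤ _ (p≤q⇒0≤q-p (minimal b-min i i≤N)) split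
      where
      split : u i - u b ≡ s * ι (i ∸ b) + ((u i - s * ι i) - (u b - s * ι b))
      split rewrite ι-∸ b≤i = solve 5 (λ uᵢ u_b s ι_b δ → uᵢ :- u_b := s :* δ :+ ((uᵢ :- s :* (ι_b :+ δ)) :- (u_b :- s :* ι_b)))
        refl (u i) (u b) s (ι b) (ι (i ∸ b))

    minimiser-from-sides : ∀ {t a} → a ℕ.≤ N → (∀ i → i ℕ.≤ a → tilt t u a ≤ tilt t u i) →
                           BelowRightChords a t → Minimiser t a
    minimiser-from-sides {t} {a} a≤N left right = record { in-range = a≤N ; minimal = minimal′ }
      where
      minimal′ : ∀ i → i ℕ.≤ N → tilt t u a ≤ tilt t u i
      minimal′ i i≤N with ℕ.≤-total i a
      ... | inj₁ i≤a = left i i≤a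
      ... | inj₂ a≤i with ℕ.m≤n⇒m<n∨m≡n a≤i
      ...   | inj₂ refl = ≤-refl
      ...   | inj₁ a<i = slack⇒≤ _ (p≤q⇒0≤q-p (below right i a<i i≤N)) split
        where
        split : u i - t * ι i ≡ (u a - t * ι a) + ((u i - u a) - t * ι (i ∸ a))
        split rewrite ι-∸ a≤i = solve 5 (λ uᵢ uₐ t ιₐ δ → uᵢ :- t :* (ιₐ :+ δ) := (uₐ :- t :* ιₐ) :+ ((uᵢ :- uₐ) :- t :* δ))
          refl (u i) (u a) t (ι a) (ι (i ∸ a))

    minimiser-at-0 : ∀ {t} → BelowRightChords 0 t → Minimiser t 0
    minimiser-at-0 = minimiser-from-sides z≤n λ { i z≤n → ≤-refl }

    minimiser-left-when-steeper : ∀ {s t a} → Minimiser s a → s ≤ t → ∀ i → i ℕ.≤ a → tilt t u a ≤ tilt t u i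
    minimiser-left-when-steeper {s} {t} {a} a-min s≤t i i≤a =
      slack⇒≤ _ (+-mono-≤ (p≤q⇒0≤q-p (minimal a-min i (ℕ.≤-trans i≤a (in-range a-min))))
                         (nonNeg*nonNeg (p≤q⇒0≤q-p s≤t) (ι-nonNeg (a ∸ i))))
        split
      where
      split : u i - t * ι i ≡ (u a - t * ι a) + ((u i - s * ι i) - (u a - s * ι a) + (t - s) * ι (a ∸ i))
      split rewrite ι-∸ i≤a = solve 6 (λ uᵢ uₐ s t ιᵢ δ → uᵢ :- t :* ιᵢ := (uₐ :- t :* (ιᵢ :+ δ)) :+ ((uᵢ :- s :* ιᵢ) :- (uₐ :- s :* (ιᵢ :+ δ)) :+ (t :- s) :* δ))
        refl (u i) (u a) s t (ι i) (ι (a ∸ i))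

    minimiser-slope-≤-chord : ∀ {s t b b′} → Minimiser s b → b ℕ.< b′ → b′ ℕ.≤ N →
                              t * ι (b′ ∸ b) ≡ u b′ - u b → s ≤ t
    minimiser-slope-≤-chord {s} {t} {b} {b′} b-min b<b′ b′≤N chord = begin
        s                   ≡⟨ cancel s ⟨
        s * ι (b′ ∸ b) * r  ≤⟨ *-monoʳ-≤-nonNeg r {{nonNegative (recip-nonNeg (b′ ∸ suc b))}}
                                 (≤-trans (minimiser-below-chords b-min b′ (ℕ.<⇒≤ b<b′) b′≤N) (≤-reflexive (sym chord))) ⟩
        t * ι (b′ ∸ b) * r  ≡⟨ cancel t ⟩
        t                   ∎
      where
      open ≤-Reasoning
      r = recip (b′ ∸ suc b)
      cancel : ∀ x → x * ι (b′ ∸ b) * r ≡ x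
      cancel x = begin-equality
        x * ι (b′ ∸ b) * r    ≡⟨ *-assoc x _ r ⟩
        x * (ι (b′ ∸ b) * r)  ≡⟨ cong (x *_) (trans (*-comm _ r) (recip*ι-∸ b<b′)) ⟩
        x * 1ℚ                ≡⟨ *-identityʳ x ⟩
        x                     ∎

    minimiser-along-chord : ∀ {t b b′} → Minimiser t b → b ℕ.≤ b′ → b′ ℕ.≤ N →
                            t * ι (b′ ∸ b) ≡ u b′ - u b → Minimiser t b′
    minimiser-along-chord {t} {b} {b′} b-min b≤b′ b′≤N chord = record
      { in-range = b′≤N ; minimal = λ i i≤N → ≤-trans (≤-reflexive same-tilt) (minimal b-min i i≤N) }
      where
      u-b′ : u b′ ≡ u b + t * ι (b′ ∸ b)
      u-b′ = trans (solve 2 (λ x y → x := y :+ (x :- y)) refl (u b′) (u b)) (cong (λ z → u b + z) (sym chord))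
      same-tilt : tilt t u b′ ≡ tilt t u b
      same-tilt = begin
        u b′ - t * ι b′                                  ≡⟨ cong₂ (λ w z → w - t * z) u-b′ (ι-∸ b≤b′) ⟩
        (u b + t * ι (b′ ∸ b)) - t * (ι b + ι (b′ ∸ b))  ≡⟨ solve 4 (λ u_b t ι_b δ → (u_b :+ t :* δ) :- t :* (ι_b :+ δ) := u_b :- t :* ι_b)
                                                               refl (u b) t (ι b) (ι (b′ ∸ b)) ⟩
        u b - t * ι b                                    ∎
        where open ≡-Reasoning

    chordSlope : ℕ → ℕ → ℚ
    chordSlope b i = (u i - u b) * recip (i ∸ suc b)

    chordSlope-chord : ∀ {b i} → b ℕ.< i → chordSlope b i * ι (i ∸ b) ≡ u i - u b
    chordSlope-chord {b} {i} b<i = begin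
      (u i - u b) * recip (i ∸ suc b) * ι (i ∸ b)    ≡⟨ *-assoc (u i - u b) _ _ ⟩
      (u i - u b) * (recip (i ∸ suc b) * ι (i ∸ b))  ≡⟨ cong ((u i - u b) *_) (recip*ι-∸ b<i) ⟩
      (u i - u b) * 1ℚ                               ≡⟨ *-identityʳ (u i - u b) ⟩
      u i - u b                                      ∎
      where open ≡-Reasoning

    hullEdge : ∀ b → b ℕ.< N → HullEdge b
    hullEdge b b<N with argmin-range (chordSlope b) (suc b) (N ∸ suc b)
    ... | j , b<j , j≤e , steepest = record
      { end = j ; slope = chordSlope b j ; b<end = b<j ; end≤N = subst (j ℕ.≤_) N≡ j≤e
      ; supporting = supporting ; through-end = chordSlope-chord b<j }
      where
      N≡ : N ∸ suc b ℕ.+ suc b ≡ N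
      N≡ = ℕ.m∸n+n≡m b<N
      supporting : BelowRightChords b (chordSlope b j)
      supporting .below i b<i i≤N = ≤-trans
        (*-monoʳ-≤-nonNeg (ι (i ∸ b)) {{nonNegative (ι-nonNeg (i ∸ b))}} (steepest i b<i (subst (i ℕ.≤_) (sym N≡) i≤N)))
        (≤-reflexive (chordSlope-chord b<i))

    belowRightChords-exists : ∀ b → ∃ (BelowRightChords b)
    belowRightChords-exists b with b ℕ.<? N
    ... | yes b<N = HullEdge.slope e , HullEdge.supporting e where e = hullEdge b b<N
    ... | no b≮N = 0ℚ , belowRightChords-beyond b≮N

  module Supports (n m : ℕ) (u v : ℕ → ℚ) where
    module U = Minimisers n u
    module V = Minimisers m v

    -- The line of slope `slope` through the minimum of the tilted sums supports W,
    -- and the minimisers bracket k so that this line is Δ-close to W at k.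
    record Support (k : ℕ) : Set where
      constructor support
      field
        slope : ℚ
        a b c d : ℕ
        a-min : U.Minimiser slope a
        b-min : U.Minimiser slope b
        c-min : V.Minimiser slope c
        d-min : V.Minimiser slope d
        a+c≤k : a ℕ.+ c ℕ.≤ k
        k≤b+d : k ℕ.≤ b ℕ.+ d

    support₀ : Support 0
    support₀ with U.belowRightChords-exists 0 | V.belowRightChords-exists 0
    ... | tu , u-below | tv , v-below =
      support (tu ⊓ tv) 0 0 0 0 u-min u-min v-min v-min z≤n z≤n
      where
      u-min : U.Minimiser (tu ⊓ tv) 0
      u-min = U.minimiser-at-0 (U.belowRightChords-mono (p⊓q≤p tu tv) u-below)
      v-min : V.Minimiser (tu ⊓ tv) 0
      v-min = V.minimiser-at-0 (V.belowRightChords-mono (p⊓q≤q tu tv) v-below)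

    advance-u : ∀ {k} (T : Support k) → Support.b T ℕ.+ Support.d T ≡ k → (e : U.HullEdge (Support.b T)) →
                V.BelowRightChords (Support.d T) (U.HullEdge.slope e) → Support (suc k)
    advance-u (support s a b c d a-min b-min c-min d-min a+c≤k k≤b+d) refl e v-below =
      support t b b′ d d b-min′ b′-min d-min′ d-min′ (ℕ.n≤1+n _) (ℕ.+-monoˡ-≤ d b<end)
      where
      open U.HullEdge e renaming (end to b′; slope to t)
      s≤t : s ≤ t
      s≤t = U.minimiser-slope-≤-chord b-min b<end end≤N through-end
      b-min′ : U.Minimiser t b
      b-min′ = U.minimiser-from-sides (U.Minimiser.in-range b-min) (U.minimiser-left-when-steeper b-min s≤t) supporting
      b′-min : U.Minimiser t b′
      b′-min = U.minimiser-along-chord b-min′ (ℕ.<⇒≤ b<end) end≤N through-end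
      d-min′ : V.Minimiser t d
      d-min′ = V.minimiser-from-sides (V.Minimiser.in-range d-min) (V.minimiser-left-when-steeper d-min s≤t) v-below

    advance-v : ∀ {k} (T : Support k) → Support.b T ℕ.+ Support.d T ≡ k → (e : V.HullEdge (Support.d T)) →
                U.BelowRightChords (Support.b T) (V.HullEdge.slope e) → Support (suc k)
    advance-v (support s a b c d a-min b-min c-min d-min a+c≤k k≤b+d) refl e u-below =
      support t b b d d′ b-min′ b-min′ d-min′ d′-min (ℕ.n≤1+n _)
        (subst (ℕ._≤ b ℕ.+ d′) (ℕ.+-suc b d) (ℕ.+-monoʳ-≤ b d<end))
      where
      open V.HullEdge e renaming (end to d′; slope to t; b<end to d<end)
      s≤t : s ≤ t
      s≤t = V.minimiser-slope-≤-chord d-min d<end end≤N through-end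
      d-min′ : V.Minimiser t d
      d-min′ = V.minimiser-from-sides (V.Minimiser.in-range d-min) (V.minimiser-left-when-steeper d-min s≤t) supporting
      d′-min : V.Minimiser t d′
      d′-min = V.minimiser-along-chord d-min′ (ℕ.<⇒≤ d<end) end≤N through-end
      b-min′ : U.Minimiser t b
      b-min′ = U.minimiser-from-sides (U.Minimiser.in-range b-min) (U.minimiser-left-when-steeper b-min s≤t) u-below

    -- Past b + d we follow whichever of the two hull edges leaving b and d is less steep:
    -- this merges the slope sequences of the lower hulls of u and v.
    turn : ∀ {k} (T : Support k) → Support.b T ℕ.+ Support.d T ≡ k → suc k ℕ.≤ n ℕ.+ m → Support (suc k)
    turn {k} T b+d≡k k<n+m with Support.b T ℕ.<? n | Support.d T ℕ.<? m
    ... | yes b<n | yes d<m = less-steep-first (U.hullEdge _ b<n) (V.hullEdge _ d<m)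
      where
      less-steep-first : U.HullEdge (Support.b T) → V.HullEdge (Support.d T) → Support (suc k)
      less-steep-first eu ev with ≤-total (U.HullEdge.slope eu) (V.HullEdge.slope ev)
      ... | inj₁ su≤sv = advance-u T b+d≡k eu (V.belowRightChords-mono su≤sv (V.HullEdge.supporting ev))
      ... | inj₂ sv≤su = advance-v T b+d≡k ev (U.belowRightChords-mono sv≤su (U.HullEdge.supporting eu))
    ... | yes b<n | no d≮m = advance-u T b+d≡k (U.hullEdge _ b<n) (V.belowRightChords-beyond d≮m)
    ... | no b≮n | yes d<m = advance-v T b+d≡k (V.hullEdge _ d<m) (U.belowRightChords-beyond b≮n)
    ... | no b≮n | no d≮m = ⊥-elim (ℕ.<⇒≱ k<n+m
          (subst (n ℕ.+ m ℕ.≤_) b+d≡k (ℕ.+-mono-≤ (ℕ.≮⇒≥ b≮n) (ℕ.≮⇒≥ d≮m))))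

    next : ∀ {k} → Support k → suc k ℕ.≤ n ℕ.+ m → Support (suc k)
    next {k} T k<n+m with suc k ℕ.≤? Support.b T ℕ.+ Support.d T
    ... | yes k<b+d = let open Support T in
          support slope a b c d a-min b-min c-min d-min (ℕ.≤-trans a+c≤k (ℕ.n≤1+n k)) k<b+d
    ... | no k≮b+d = turn T (ℕ.≤-antisym (ℕ.≤-pred (ℕ.≰⇒> k≮b+d)) (Support.k≤b+d T)) k<n+m

    supportAt : ∀ k → k ℕ.≤ n ℕ.+ m → Support k
    supportAt zero    _      = support₀
    supportAt (suc k) k<n+m = next (supportAt k (ℕ.<⇒≤ k<n+m)) k<n+m

  record NearConvexOn (N : ℕ) (Δ : ℚ) (u : ℕ → ℚ) : Set where
    field
      envelope : ℕ → ℚ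
      envelope-convex : ConvexOn N envelope
      envelope-≤ : ∀ {x} → x ℕ.≤ N → envelope x ≤ u x
      ≤-envelope+Δ : ∀ {x} → x ℕ.≤ N → u x ≤ envelope x + Δ

  module _ {N Δ u} (near : NearConvexOn N Δ u) where
    open NearConvexOn near
    open Minimisers N u

    tilt-between-minimisers : ∀ {s c d j} → Minimiser s c → Minimiser s d → c ℕ.≤ j → j ℕ.≤ d →
                              tilt s u j ≤ tilt s u c + Δ
    tilt-between-minimisers {s} {c} {d} {j} c-min d-min c≤j j≤d = begin
      u j - s * ι j               ≤⟨ +-monoˡ-≤ (- (s * ι j)) (≤-envelope+Δ j≤N) ⟩
      (envelope j + Δ) - s * ι j  ≡⟨ solve 3 (λ e Δ t → (e :+ Δ) :- t := (e :- t) :+ Δ) refl (envelope j) Δ (s * ι j) ⟩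
      tilt s envelope j + Δ       ≤⟨ +-monoˡ-≤ Δ (convex-≤-endpoints (tilt-convex {B = envelope} s envelope-convex) c≤j j≤d d≤N
                                       (envelope-tilt (Minimiser.in-range c-min))
                                       (≤-trans (envelope-tilt d≤N) (Minimiser.minimal d-min c (Minimiser.in-range c-min)))) ⟩
      tilt s u c + Δ              ∎
      where
      open ≤-Reasoning
      d≤N = Minimiser.in-range d-min
      j≤N = ℕ.≤-trans j≤d d≤N
      envelope-tilt : ∀ {x} → x ℕ.≤ N → tilt s envelope x ≤ tilt s u x
      envelope-tilt x≤N = +-monoˡ-≤ _ (envelope-≤ x≤N)

  record IsMinPlusConvOn (n m : ℕ) (u v W : ℕ → ℚ) : Set where
    field
      attained : ∀ {x} → x ℕ.≤ n ℕ.+ m → ∃₂ λ i j → i ℕ.≤ n × j ℕ.≤ m × i ℕ.+ j ≡ x × W x ≡ u i + v j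
      ≤-sum : ∀ {i j} → i ℕ.≤ n → j ℕ.≤ m → W (i ℕ.+ j) ≤ u i + v j

  +-tilt : ∀ s u v i j → u i + v j ≡ tilt s u i + tilt s v j + s * ι (i ℕ.+ j)
  +-tilt s u v i j rewrite ι-+ i j =
    solve 5 (λ uᵢ vⱼ s ιᵢ ιⱼ → uᵢ :+ vⱼ := (uᵢ :- s :* ιᵢ) :+ (vⱼ :- s :* ιⱼ) :+ s :* (ιᵢ :+ ιⱼ))
      refl (u i) (v j) s (ι i) (ι j)

  module MinPlus {n m Δf Δg u v W} (u-near : NearConvexOn n Δf u) (v-near : NearConvexOn m Δg v)
                 (conv : IsMinPlusConvOn n m u v W) where
    open Supports n m u v
    open IsMinPlusConvOn conv

    L : ℕ
    L = n ℕ.+ m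

    Δ : ℚ
    Δ = Δf ⊔ Δg

    intercept : ∀ {k} → Support k → ℚ
    intercept T = tilt (Support.slope T) u (Support.a T) + tilt (Support.slope T) v (Support.c T)

    line : ∀ {k} → Support k → ℕ → ℚ
    line T = affine (intercept T) (Support.slope T)

    line≤W : ∀ {k} (T : Support k) {x} → x ℕ.≤ L → line T x ≤ W x
    line≤W (support s a b c d a-min b-min c-min d-min _ _) x≤L with attained x≤L
    ... | i , j , i≤n , j≤m , refl , W≡ = begin
      tilt s u a + tilt s v c + s * ι (i ℕ.+ j)  ≤⟨ +-monoˡ-≤ _ (+-mono-≤ (U.Minimiser.minimal a-min i i≤n)
                                                                         (V.Minimiser.minimal c-min j j≤m)) ⟩
      tilt s u i + tilt s v j + s * ι (i ℕ.+ j)  ≡⟨ +-tilt s u v i j ⟨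
      u i + v j                                  ≡⟨ W≡ ⟨
      W (i ℕ.+ j)                                ∎
      where open ≤-Reasoning

    near-minimal-split : ∀ {k} (T : Support k) → ∃₂ λ i j → i ℕ.≤ n × j ℕ.≤ m × i ℕ.+ j ≡ k ×
                         tilt (Support.slope T) u i + tilt (Support.slope T) v j ≤ intercept T + Δ
    near-minimal-split {k} (support s a b c d a-min b-min c-min d-min a+c≤k k≤b+d) with k ℕ.≤? a ℕ.+ d
    ... | yes k≤a+d = a , k ∸ a , U.Minimiser.in-range a-min , ℕ.≤-trans j≤d (V.Minimiser.in-range d-min) ,
                      ℕ.m+[n∸m]≡n a≤k , (begin
        tilt s u a + tilt s v (k ∸ a)   ≤⟨ +-monoʳ-≤ (tilt s u a) (tilt-between-minimisers v-near c-min d-min c≤j j≤d) ⟩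
        tilt s u a + (tilt s v c + Δg)  ≤⟨ +-monoʳ-≤ (tilt s u a) (+-monoʳ-≤ (tilt s v c) (p≤q⊔p Δf Δg)) ⟩
        tilt s u a + (tilt s v c + Δ)   ≡⟨ +-assoc (tilt s u a) (tilt s v c) Δ ⟨
        tilt s u a + tilt s v c + Δ     ∎)
      where
      open ≤-Reasoning
      a≤k : a ℕ.≤ k
      a≤k = ℕ.≤-trans (ℕ.m≤m+n a c) a+c≤k
      c≤j : c ℕ.≤ k ∸ a
      c≤j = subst (ℕ._≤ k ∸ a) (ℕ.m+n∸m≡n a c) (ℕ.∸-monoˡ-≤ a a+c≤k)
      j≤d : k ∸ a ℕ.≤ d
      j≤d = ℕ.m≤n+o⇒m∸n≤o k a k≤a+d
    ... | no k≰a+d = k ∸ d , d , ℕ.≤-trans i≤b (U.Minimiser.in-range b-min) , V.Minimiser.in-range d-min ,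
                     ℕ.m∸n+n≡m d≤k , (begin
        tilt s u (k ∸ d) + tilt s v d   ≤⟨ +-mono-≤ (tilt-between-minimisers u-near a-min b-min a≤i i≤b)
                                                     (V.Minimiser.minimal d-min c (V.Minimiser.in-range c-min)) ⟩
        (tilt s u a + Δf) + tilt s v c  ≤⟨ +-monoˡ-≤ (tilt s v c) (+-monoʳ-≤ (tilt s u a) (p≤p⊔q Δf Δg)) ⟩
        (tilt s u a + Δ) + tilt s v c   ≡⟨ solve 3 (λ x Δ y → (x :+ Δ) :+ y := (x :+ y) :+ Δ) refl (tilt s u a) Δ (tilt s v c) ⟩
        tilt s u a + tilt s v c + Δ     ∎)
      where
      open ≤-Reasoning
      a+d≤k : a ℕ.+ d ℕ.≤ k
      a+d≤k = ℕ.<⇒≤ (ℕ.≰⇒> k≰a+d)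
      d≤k : d ℕ.≤ k
      d≤k = ℕ.≤-trans (ℕ.m≤n+m d a) a+d≤k
      a≤i : a ℕ.≤ k ∸ d
      a≤i = subst (ℕ._≤ k ∸ d) (ℕ.m+n∸n≡m a d) (ℕ.∸-monoˡ-≤ d a+d≤k)
      i≤b : k ∸ d ℕ.≤ b
      i≤b = ℕ.m≤n+o⇒m∸n≤o k d (subst (k ℕ.≤_) (ℕ.+-comm b d) k≤b+d)

    W≤line+Δ : ∀ {k} (T : Support k) → W k ≤ line T k + Δ
    W≤line+Δ T with near-minimal-split T
    ... | i , j , i≤n , j≤m , refl , split≤ = begin
      W (i ℕ.+ j)                                ≤⟨ ≤-sum i≤n j≤m ⟩
      u i + v j                                  ≡⟨ +-tilt s u v i j ⟩
      tilt s u i + tilt s v j + s * ι (i ℕ.+ j)  ≤⟨ +-monoˡ-≤ _ split≤ ⟩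
      intercept T + Δ + s * ι (i ℕ.+ j)          ≡⟨ solve 3 (λ c Δ y → (c :+ Δ) :+ y := (c :+ y) :+ Δ) refl (intercept T) Δ (s * ι (i ℕ.+ j)) ⟩
      intercept T + s * ι (i ℕ.+ j) + Δ          ∎
      where
      open ≤-Reasoning
      s = Support.slope T

    clampedSupport : (k : ℕ) → Support (k ℕ.⊓ L)
    clampedSupport k = supportAt (k ℕ.⊓ L) (ℕ.m⊓n≤n k L)

    envelope : ℕ → ℚ
    envelope x = maxUpTo (λ k → line (clampedSupport k) x) L

    envelope-convex : ConvexOn L envelope
    envelope-convex = maxUpTo-affine-convex (λ k → intercept (clampedSupport k)) (λ k → Support.slope (clampedSupport k)) L L

    envelope-≤ : ∀ {x} → x ℕ.≤ L → envelope x ≤ W x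
    envelope-≤ x≤L = maxUpTo-lub _ L (λ k _ → line≤W (clampedSupport k) x≤L)

    ≤-envelope+Δ : ∀ {x} → x ℕ.≤ L → W x ≤ envelope x + Δ
    ≤-envelope+Δ {x} x≤L = begin
      W x                 ≡⟨ cong W x⊓L≡x ⟨
      W (x ℕ.⊓ L)         ≤⟨ W≤line+Δ T ⟩
      line T (x ℕ.⊓ L) + Δ ≡⟨ cong (λ y → line T y + Δ) x⊓L≡x ⟩
      line T x + Δ        ≤⟨ +-monoˡ-≤ Δ (≤-maxUpTo (λ k → line (clampedSupport k) x) x≤L) ⟩
      envelope x + Δ      ∎
      where
      open ≤-Reasoning
      T = clampedSupport x
      x⊓L≡x = ℕ.m≤n⇒m⊓n≡m x≤L

  minPlus-nearConvex : ∀ {n m Δf Δg u v W} → NearConvexOn n Δf u → NearConvexOn m Δg v →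
                       IsMinPlusConvOn n m u v W → NearConvexOn (n ℕ.+ m) (Δf ⊔ Δg) W
  minPlus-nearConvex u-near v-near conv = record
    { envelope = envelope ; envelope-convex = envelope-convex
    ; envelope-≤ = envelope-≤ ; ≤-envelope+Δ = ≤-envelope+Δ }
    where open MinPlus u-near v-near conv

  clamp : (N x : ℕ) → Fin (suc N)
  clamp N x with x ℕ.≤? N
  ... | yes x≤N = fromℕ< (s≤s x≤N)
  ... | no _    = fromℕ N

  toℕ-clamp : ∀ {N x} → x ℕ.≤ N → toℕ (clamp N x) ≡ x
  toℕ-clamp {N} {x} x≤N with x ℕ.≤? N
  ... | yes x≤N′ = Fin.toℕ-fromℕ< (s≤s x≤N′)
  ... | no x≰N   = ⊥-elim (x≰N x≤N)

  clamp-toℕ : ∀ {N} (i : Fin (suc N)) → clamp N (toℕ i) ≡ i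
  clamp-toℕ i = Fin.toℕ-injective (toℕ-clamp (Fin.toℕ≤pred[n] i))

  -- Arguments beyond N are clamped to N; only values on [0, N] are ever used.
  extend : ∀ N → (Fin (suc N) → ℤ) → ℕ → ℚ
  extend N f x = toℚ (f (clamp N x))

  extend-toℕ : ∀ {N} f (i : Fin (suc N)) → extend N f (toℕ i) ≡ toℚ (f i)
  extend-toℕ f i = cong (λ j → toℚ (f j)) (clamp-toℕ i)

  convex-onℕ : ∀ {N b} → Convex N b → ConvexOn N (b ∘ clamp N)
  convex-onℕ {N} convex x x+2≤N =
    convex (clamp N x) (clamp N (suc x)) (clamp N (suc (suc x))) (consecutive x (ℕ.<⇒≤ x+2≤N)) (consecutive (suc x) x+2≤N)
    where
    consecutive : ∀ y → suc y ℕ.≤ N → suc (toℕ (clamp N y)) ≡ toℕ (clamp N (suc y))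
    consecutive y y<N = trans (cong suc (toℕ-clamp (ℕ.<⇒≤ y<N))) (sym (toℕ-clamp y<N))

  nearConvex-onℕ : ∀ {N Δ} f → NearConvex N Δ f → NearConvexOn N Δ (extend N f)
  nearConvex-onℕ {N} _ (b , convex , b≤f , f≤b+Δ) = record
    { envelope = b ∘ clamp N ; envelope-convex = convex-onℕ {b = b} convex
    ; envelope-≤ = λ _ → b≤f _ ; ≤-envelope+Δ = λ _ → f≤b+Δ _ }

  nearConvex-onFin : ∀ {N Δ} f → NearConvexOn N Δ (extend N f) → NearConvex N Δ f
  nearConvex-onFin {N} {Δ} f near = envelope ∘ toℕ , convex , lower , upper
    where
    open NearConvexOn near
    convex : Convex N (envelope ∘ toℕ)
    convex i j k i+1≡j j+1≡k =
      subst₂ (λ y z → envelope y - envelope (toℕ i) ≤ envelope z - envelope y) i+1≡j i+2≡k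
        (envelope-convex (toℕ i) (subst (ℕ._≤ N) (sym i+2≡k) (Fin.toℕ≤pred[n] k)))
      where
      i+2≡k : suc (suc (toℕ i)) ≡ toℕ k
      i+2≡k = trans (cong suc i+1≡j) j+1≡k
    lower : ∀ i → envelope (toℕ i) ≤ toℚ (f i)
    lower i = subst (envelope (toℕ i) ≤_) (extend-toℕ f i) (envelope-≤ (Fin.toℕ≤pred[n] i))
    upper : ∀ i → toℚ (f i) ≤ envelope (toℕ i) + Δ
    upper i = subst (_≤ envelope (toℕ i) + Δ) (extend-toℕ f i) (≤-envelope+Δ (Fin.toℕ≤pred[n] i))

  minPlus-onℕ : ∀ {n m} f g h → IsMaxPlusConv n m f g h →
                IsMinPlusConvOn n m (extend n (λ i → ℤ.- f i)) (extend m (λ j → ℤ.- g j)) (extend (n ℕ.+ m) (λ k → ℤ.- h k))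
  minPlus-onℕ {n} {m} f g h conv = record { attained = attained ; ≤-sum = ≤-sum }
    where
    open ≤-Reasoning
    toℚ-neg-+ : ∀ a b → toℚ (ℤ.- (a ℤ.+ b)) ≡ toℚ (ℤ.- a) + toℚ (ℤ.- b)
    toℚ-neg-+ a b = trans (cong toℚ (ℤ.neg-distrib-+ a b)) (toℚ-+ (ℤ.- a) (ℤ.- b))
    attained : ∀ {x} → x ℕ.≤ n ℕ.+ m → ∃₂ λ i j → i ℕ.≤ n × j ℕ.≤ m × i ℕ.+ j ≡ x ×
               toℚ (ℤ.- h (clamp (n ℕ.+ m) x)) ≡ toℚ (ℤ.- f (clamp n i)) + toℚ (ℤ.- g (clamp m j))
    attained {x} x≤n+m with proj₁ (conv (clamp (n ℕ.+ m) x))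
    ... | i , j , i+j≡ , h≡ = toℕ i , toℕ j , Fin.toℕ≤pred[n] i , Fin.toℕ≤pred[n] j ,
                              trans i+j≡ (toℕ-clamp x≤n+m) , (begin-equality
      toℚ (ℤ.- h (clamp (n ℕ.+ m) x))                            ≡⟨ cong (λ z → toℚ (ℤ.- z)) h≡ ⟩
      toℚ (ℤ.- (f i ℤ.+ g j))                                    ≡⟨ toℚ-neg-+ (f i) (g j) ⟩
      toℚ (ℤ.- f i) + toℚ (ℤ.- g j)                              ≡⟨ cong₂ _+_ (extend-toℕ (λ i → ℤ.- f i) i) (extend-toℕ (λ j → ℤ.- g j) j) ⟨
      toℚ (ℤ.- f (clamp n (toℕ i))) + toℚ (ℤ.- g (clamp m (toℕ j))) ∎)
    ≤-sum : ∀ {i j} → i ℕ.≤ n → j ℕ.≤ m →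
            toℚ (ℤ.- h (clamp (n ℕ.+ m) (i ℕ.+ j))) ≤ toℚ (ℤ.- f (clamp n i)) + toℚ (ℤ.- g (clamp m j))
    ≤-sum {i} {j} i≤n j≤m = begin
      toℚ (ℤ.- h (clamp (n ℕ.+ m) (i ℕ.+ j)))          ≤⟨ toℚ-mono-≤ (ℤ.neg-mono-≤ (proj₂ (conv (clamp (n ℕ.+ m) (i ℕ.+ j))) (clamp n i) (clamp m j) indices)) ⟩
      toℚ (ℤ.- (f (clamp n i) ℤ.+ g (clamp m j)))      ≡⟨ toℚ-neg-+ (f (clamp n i)) (g (clamp m j)) ⟩
      toℚ (ℤ.- f (clamp n i)) + toℚ (ℤ.- g (clamp m j)) ∎
      where
      indices : toℕ (clamp n i) ℕ.+ toℕ (clamp m j) ≡ toℕ (clamp (n ℕ.+ m) (i ℕ.+ j))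
      indices = trans (cong₂ ℕ._+_ (toℕ-clamp i≤n) (toℕ-clamp j≤m)) (sym (toℕ-clamp (ℕ.+-mono-≤ i≤n j≤m)))

open NearConvexMinPlus using (nearConvex-onℕ; nearConvex-onFin; minPlus-onℕ; minPlus-nearConvex)
open import Data.Nat using (ℕ; suc; _+_)
open import Data.Fin using (Fin)
open import Data.Integer using (ℤ; -_)
open import Data.Rational using (ℚ; _≤_; _⊔_; 0ℚ)
open import Data.Rational.Properties using (≤-refl)
open import Data.Product using (Σ; _×_; _,_)

lemma3p6 : (n m : ℕ) (Δf Δg : ℚ) (f : Fin (suc n) → ℤ) (g : Fin (suc m) → ℤ)
    (h : Fin (suc (n + m)) → ℤ) →
    0ℚ ≤ Δf → 0ℚ ≤ Δg →
    NearConcave n Δf f → NearConcave m Δg g → IsMaxPlusConv n m f g h →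
    Σ ℚ λ Δh → (Δh ≤ Δf ⊔ Δg) × NearConcave (n + m) Δh h
lemma3p6 n m Δf Δg f g h _ _ f-concave g-concave conv =
  Δf ⊔ Δg , ≤-refl ,
  nearConvex-onFin (λ k → - h k)
    (minPlus-nearConvex (nearConvex-onℕ (λ i → - f i) f-concave) (nearConvex-onℕ (λ j → - g j) g-concave)
      (minPlus-onℕ f g h conv))
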